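{- For any $n \ge 1$ and positive integers $a_1, \ldots, a_n$, we have $\bigstar a_1 + \cdots + \bigstar a_n \in \mathcal{P}$ if and only if $a_1 \oplus \cdots \oplus a_n = 0$.
   Context: Positions are defined recursively: $*L$ and $*R$ are terminal positions; if $G_1,\dots,G_k$ ($k\ge 1$) are positions, then $\{G_1,\dots,G_k\}$ is a position with options $G_1,\dots,G_k$. All positions have finite game trees. Play: Left and Right move alternately, each choosing any option of the current position; when a terminal position is reached, Left wins if it is $*L$ and Right wins if it is $*R$. Disjunctive sum: $*L + *L = *R + *R = *L$, $*L + *R = *R + *L = *R$; if at least one of $G,H$ is non-terminal, $G+H$ has options all $G'+H$ ($G'$ an option of $G$) and all $G+H'$ ($H'$ an option of $H$). Outcome class $\mathcal{P}$: the player who moves second has a winning strategy. Define $\bigstar 1 = \{*L, *R\}$ and, for $m > 1$, $\bigstar m = \{\bigstar(m-1), \ldots, \bigstar 1, *L, *R\}$. The symbol $\oplus$ denotes bitwise XOR (nim-sum) of nonnegative integers. -}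

module Defs where

open import Data.Nat using (ℕ; zero; suc; _+_; _*_; _/_; _%_; NonZero)
open import Data.Fin using (Fin; zero; suc; splitAt)
open import Data.Sum using (_⊎_; [_,_]′)
open import Data.Product using (Σ)
open import Data.Unit using (⊤)
open import Data.Empty using (⊥)

data Pos : Set where
  *L *R : Pos
  node  : (k : ℕ) → (Fin (suc k) → Pos) → Pos

infixl 6 _⊞_
_⊞_ : Pos → Pos → Pos
*L ⊞ *L = *L
*L ⊞ *R = *R
*R ⊞ *L = *R
*R ⊞ *R = *L
*L ⊞ node k h = node k (λ j → *L ⊞ h j)
*R ⊞ node k h = node k (λ j → *R ⊞ h j)
node k g ⊞ *L = node k (λ i → g i ⊞ *L)
node k g ⊞ *R = node k (λ i → g i ⊞ *R)
node k g ⊞ node m h =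
  node (k + suc m)
       (λ x → [ (λ i → g i ⊞ node m h) , (λ j → node k g ⊞ h j) ]′ (splitAt (suc k) x))

-- Winning conditions (who is to move is part of the predicate).
-- LeftWinsL G : Left, moving first from G, has a winning strategy.
-- LeftWinsR G : Left wins from G when Right is to move.
LeftWinsL LeftWinsR : Pos → Set
LeftWinsL *L = ⊤
LeftWinsL *R = ⊥
LeftWinsL (node k g) = Σ (Fin (suc k)) (λ i → LeftWinsR (g i))
LeftWinsR *L = ⊤
LeftWinsR *R = ⊥
LeftWinsR (node k g) = (i : Fin (suc k)) → LeftWinsL (g i)

-- RightWinsR G : Right, moving first from G, has a winning strategy.
-- RightWinsL G : Right wins from G when Left is to move.
RightWinsR RightWinsL : Pos → Set
RightWinsR *L = ⊥
RightWinsR *R = ⊤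
RightWinsR (node k g) = Σ (Fin (suc k)) (λ i → RightWinsL (g i))
RightWinsL *L = ⊥
RightWinsL *R = ⊤
RightWinsL (node k g) = (i : Fin (suc k)) → RightWinsR (g i)

InP : Pos → Set
InP G = RightWinsL G × LeftWinsR G
  where open import Data.Product using (_×_)

-- ★ options: starOpts m lists the options of ★(m+1):
-- ★m, …, ★1, *L, *R.
★[1+_] : ℕ → Pos
starOpts : (m : ℕ) → Fin (suc (suc m)) → Pos
★[1+ m ] = node (suc m) (starOpts m)
starOpts zero zero = *L
starOpts zero (suc zero) = *R
starOpts (suc m) zero = ★[1+ m ]
starOpts (suc m) (suc i) = starOpts m i

★ : (m : ℕ) → .{{NonZero m}} → Pos
★ (suc m) = ★[1+ m ]

-- Bitwise XOR on ℕ (fuel-based recursion on binary digits; fuel x + y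
-- always suffices since each step halves both arguments).
bitxor : ℕ → ℕ → ℕ
bitxor 0 0 = 0
bitxor 0 1 = 1
bitxor 1 0 = 1
bitxor _ _ = 0

xorFuel : ℕ → ℕ → ℕ → ℕ
xorFuel zero x y = 0
xorFuel (suc f) x y = bitxor (x % 2) (y % 2) + 2 * xorFuel f (x / 2) (y / 2)

_⊕_ : ℕ → ℕ → ℕ
x ⊕ y = xorFuel (x + y) x y

sumPos : (n : ℕ) → (Fin (suc n) → Pos) → Pos
sumPos zero G = G zero
sumPos (suc n) G = sumPos n (λ i → G (Data.Fin.inject₁ i)) ⊞ G (Data.Fin.fromℕ (suc n))

xorAll : (n : ℕ) → (Fin (suc n) → ℕ) → ℕ
xorAll zero a = a zero
xorAll (suc n) a = xorAll n (λ i → a (Data.Fin.inject₁ i)) ⊕ a (Data.Fin.fromℕ (suc n))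

-- Sprague–Grundy theory, adapted to terminal positions. Say G has nim-value v
-- when its non-terminal options have values ≠ v covering every 0 < u < v,
-- terminal options occur only if v ≠ 0, and if v ≠ 0 each player can move to
-- his own terminal or to a position of value 0. Value 0 means outcome P, a
-- nonzero value a first-player win; ★ m has value m, and values add by nim-sum
-- under ⊞. For the sum, adding a terminal merely relabels the terminal leaves,
-- and a move of G to *L or to value 0 lets the mover in G ⊞ H reproduce the
-- value of H.
module Submission where

open import Defs
open import Data.Bool using (Bool; true; false; _xor_)
open import Data.Bool.Properties using (xor-comm; xor-assoc; xor-same; xor-identityʳ)
open import Data.Empty using (⊥; ⊥-elim)
open import Data.Fin using (Fin; zero; suc; splitAt; _↑ˡ_; _↑ʳ_; inject₁; fromℕ)
open import Data.Fin.Properties using (splitAt-↑ˡ; splitAt-↑ʳ)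
open import Data.Nat
open import Data.Nat.DivMod using (m*n%n≡0; [m+kn]%n≡m%n; m*n/n≡m; +-distrib-/)
open import Data.Nat.Properties
open import Data.Product using (_×_; _,_; proj₁; proj₂; ∃-syntax; map)
open import Data.Sum using (_⊎_; inj₁; inj₂; [_,_]′)
open import Data.Unit using (tt)
open import Function using (_∘_; id)
open import Function.Bundles using (_⇔_; mk⇔)
open import Relation.Binary.Definitions using (tri<; tri≈; tri>)
open import Relation.Binary.PropositionalEquality
open import Relation.Nullary using (yes; no; contradiction)

-- Nim-sum

bit : Bool → ℕ
bit false = 0
bit true  = 1

data Binary : ℕ → Set where
  bits : ∀ b x → Binary (bit b + x * 2)

binary : ∀ n → Binary n
binary zero = bits false 0
binary (suc n) with binary n
... | bits false x = bits true x
... | bits true  x = bits false (suc x)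

bits%2 : ∀ b x → (bit b + x * 2) % 2 ≡ bit b
bits%2 false x = m*n%n≡0 x 2
bits%2 true  x = [m+kn]%n≡m%n 1 x 2

bits/2 : ∀ b x → (bit b + x * 2) / 2 ≡ x
bits/2 false x = m*n/n≡m x 2
bits/2 true  x =
  trans (+-distrib-/ 1 (x * 2) (≤-reflexive (cong (2 +_) (m*n%n≡0 x 2)))) (m*n/n≡m x 2)

≤bits : ∀ b x → x ≤ bit b + x * 2
≤bits b x = ≤-trans (m≤m*n x 2) (m≤n+m (x * 2) (bit b))

*2≤1+⇒≤ : ∀ x {f} → x * 2 ≤ suc f → x ≤ f
*2≤1+⇒≤ zero    _                   = z≤n
*2≤1+⇒≤ (suc x) {suc f} (s≤s (s≤s x*2≤f)) = s≤s (*2≤1+⇒≤ x (m≤n⇒m≤1+n x*2≤f))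

bits≤1+⇒≤ : ∀ b x {f} → bit b + x * 2 ≤ suc f → x ≤ f
bits≤1+⇒≤ b x p = *2≤1+⇒≤ x (m+n≤o⇒n≤o (bit b) p)

bits+bits≤1+⇒≤ : ∀ b x c y {f} → (bit b + x * 2) + (bit c + y * 2) ≤ suc f → x + y ≤ f
bits+bits≤1+⇒≤ b x c y p = *2≤1+⇒≤ (x + y) (begin
  (x + y) * 2                      ≡⟨ *-distribʳ-+ 2 x y ⟩
  x * 2 + y * 2                    ≤⟨ +-mono-≤ (m≤n+m (x * 2) (bit b)) (m≤n+m (y * 2) (bit c)) ⟩
  (bit b + x * 2) + (bit c + y * 2) ≤⟨ p ⟩
  suc _                            ∎)
  where open ≤-Reasoning

bitxor-bit : ∀ b c → bitxor (bit b) (bit c) ≡ bit (b xor c)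
bitxor-bit false false = refl
bitxor-bit false true  = refl
bitxor-bit true  false = refl
bitxor-bit true  true  = refl

xorFuel-bits : ∀ f b x c y →
  xorFuel (suc f) (bit b + x * 2) (bit c + y * 2) ≡ bit (b xor c) + xorFuel f x y * 2
xorFuel-bits f b x c y = begin
  bitxor (X % 2) (Y % 2) + 2 * xorFuel f (X / 2) (Y / 2)
    ≡⟨ cong₂ (λ d r → d + 2 * r) (cong₂ bitxor (bits%2 b x) (bits%2 c y))
                                  (cong₂ (xorFuel f) (bits/2 b x) (bits/2 c y)) ⟩
  bitxor (bit b) (bit c) + 2 * xorFuel f x y
    ≡⟨ cong₂ _+_ (bitxor-bit b c) (*-comm 2 (xorFuel f x y)) ⟩
  bit (b xor c) + xorFuel f x y * 2 ∎
  where
  open ≡-Reasoning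
  X = bit b + x * 2
  Y = bit c + y * 2

xorFuel-zeros : ∀ f → xorFuel f 0 0 ≡ 0
xorFuel-zeros zero    = refl
xorFuel-zeros (suc f) = cong (2 *_) (xorFuel-zeros f)

xorFuel-irrelevant : ∀ {f g} x y → x + y ≤ f → x + y ≤ g → xorFuel f x y ≡ xorFuel g x y
xorFuel-irrelevant {zero}  {g}    zero    zero    _  _  = sym (xorFuel-zeros g)
xorFuel-irrelevant {zero}         (suc _) _       () _
xorFuel-irrelevant {zero}         zero    (suc _) () _
xorFuel-irrelevant {suc f} {zero} zero    zero    _  _  = xorFuel-zeros (suc f)
xorFuel-irrelevant {suc f} {zero} (suc _) _       _  ()
xorFuel-irrelevant {suc f} {zero} zero    (suc _) _  ()
xorFuel-irrelevant {suc f} {suc g} x y p q with binary x | binary y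
... | bits b x′ | bits c y′ = begin
  xorFuel (suc f) (bit b + x′ * 2) (bit c + y′ * 2) ≡⟨ xorFuel-bits f b x′ c y′ ⟩
  bit (b xor c) + xorFuel f x′ y′ * 2
    ≡⟨ cong (λ r → bit (b xor c) + r * 2)
            (xorFuel-irrelevant x′ y′ (bits+bits≤1+⇒≤ b x′ c y′ p)
                                      (bits+bits≤1+⇒≤ b x′ c y′ q)) ⟩
  bit (b xor c) + xorFuel g x′ y′ * 2 ≡⟨ xorFuel-bits g b x′ c y′ ⟨
  xorFuel (suc g) (bit b + x′ * 2) (bit c + y′ * 2) ∎
  where open ≡-Reasoning

⊕-bits : ∀ b x c y → (bit b + x * 2) ⊕ (bit c + y * 2) ≡ bit (b xor c) + (x ⊕ y) * 2
⊕-bits b x c y = begin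
  xorFuel (X + Y) X Y                  ≡⟨ xorFuel-irrelevant X Y ≤-refl (n≤1+n (X + Y)) ⟩
  xorFuel (suc (X + Y)) X Y            ≡⟨ xorFuel-bits (X + Y) b x c y ⟩
  bit (b xor c) + xorFuel (X + Y) x y * 2
    ≡⟨ cong (λ r → bit (b xor c) + r * 2)
            (xorFuel-irrelevant x y (+-mono-≤ (≤bits b x) (≤bits c y)) ≤-refl) ⟩
  bit (b xor c) + (x ⊕ y) * 2 ∎
  where
  open ≡-Reasoning
  X = bit b + x * 2
  Y = bit c + y * 2

binary-ind₃ : (P : ℕ → ℕ → ℕ → Set) → P 0 0 0 →
  (∀ a x b y c z → P x y z → P (bit a + x * 2) (bit b + y * 2) (bit c + z * 2)) →
  ∀ x y z → P x y z
binary-ind₃ P base step x y z =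
  go (x + y + z) (≤-trans (m≤m+n x y) (m≤m+n (x + y) z))
                 (≤-trans (m≤n+m y x) (m≤m+n (x + y) z)) (m≤n+m z (x + y))
  where
  go : ∀ f {x y z} → x ≤ f → y ≤ f → z ≤ f → P x y z
  go zero    z≤n z≤n z≤n = base
  go (suc f) {x} {y} {z} p q r with binary x | binary y | binary z
  ... | bits a x′ | bits b y′ | bits c z′ =
    step a x′ b y′ c z′
      (go f (bits≤1+⇒≤ a x′ p) (bits≤1+⇒≤ b y′ q) (bits≤1+⇒≤ c z′ r))

binary-ind₂ : (P : ℕ → ℕ → Set) → P 0 0 →
  (∀ a x b y → P x y → P (bit a + x * 2) (bit b + y * 2)) → ∀ x y → P x y
binary-ind₂ P base step x y =
  binary-ind₃ (λ x y _ → P x y) base (λ a x b y _ _ → step a x b y) x y 0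

⊕-comm : ∀ x y → x ⊕ y ≡ y ⊕ x
⊕-comm = binary-ind₂ (λ x y → x ⊕ y ≡ y ⊕ x) refl λ a x b y ih → begin
  (bit a + x * 2) ⊕ (bit b + y * 2) ≡⟨ ⊕-bits a x b y ⟩
  bit (a xor b) + (x ⊕ y) * 2       ≡⟨ cong₂ (λ d r → bit d + r * 2) (xor-comm a b) ih ⟩
  bit (b xor a) + (y ⊕ x) * 2       ≡⟨ ⊕-bits b y a x ⟨
  (bit b + y * 2) ⊕ (bit a + x * 2) ∎
  where open ≡-Reasoning

⊕-identityˡ : ∀ x → 0 ⊕ x ≡ x
⊕-identityˡ x = binary-ind₂ (λ x _ → 0 ⊕ x ≡ x) refl
  (λ a x _ _ ih → trans (⊕-bits false 0 a x) (cong (λ r → bit a + r * 2) ih)) x 0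

⊕-identityʳ : ∀ x → x ⊕ 0 ≡ x
⊕-identityʳ x = trans (⊕-comm x 0) (⊕-identityˡ x)

⊕-self : ∀ x → x ⊕ x ≡ 0
⊕-self x = binary-ind₂ (λ x _ → x ⊕ x ≡ 0) refl
  (λ a x _ _ ih → trans (⊕-bits a x a x) (cong₂ (λ d r → bit d + r * 2) (xor-same a) ih)) x 0

m⊕n⊕n≡m : ∀ m n → (m ⊕ n) ⊕ n ≡ m
m⊕n⊕n≡m = binary-ind₂ (λ m n → (m ⊕ n) ⊕ n ≡ m) refl λ a m b n ih → begin
  ((bit a + m * 2) ⊕ (bit b + n * 2)) ⊕ (bit b + n * 2)
    ≡⟨ cong (_⊕ (bit b + n * 2)) (⊕-bits a m b n) ⟩
  (bit (a xor b) + (m ⊕ n) * 2) ⊕ (bit b + n * 2)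
    ≡⟨ ⊕-bits (a xor b) (m ⊕ n) b n ⟩
  bit ((a xor b) xor b) + ((m ⊕ n) ⊕ n) * 2
    ≡⟨ cong₂ (λ d r → bit d + r * 2) (xor-cancel a b) ih ⟩
  bit a + m * 2 ∎
  where
  open ≡-Reasoning
  xor-cancel : ∀ a b → (a xor b) xor b ≡ a
  xor-cancel a b = trans (xor-assoc a b b) (trans (cong (a xor_) (xor-same b)) (xor-identityʳ a))

⊕-cancelʳ : ∀ {m n} k → m ⊕ k ≡ n ⊕ k → m ≡ n
⊕-cancelʳ {m} {n} k eq = trans (sym (m⊕n⊕n≡m m k)) (trans (cong (_⊕ k) eq) (m⊕n⊕n≡m n k))

m⊕n≡0⇒m≡n : ∀ {m n} → m ⊕ n ≡ 0 → m ≡ n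
m⊕n≡0⇒m≡n {m} {n} eq = ⊕-cancelʳ n (trans eq (sym (⊕-self n)))

⊕-preservesʳ-≢ : ∀ {m n} k → m ≢ n → m ⊕ k ≢ n ⊕ k
⊕-preservesʳ-≢ k m≢n = m≢n ∘ ⊕-cancelʳ k

⊕-preservesˡ-≢ : ∀ k {m n} → m ≢ n → k ⊕ m ≢ k ⊕ n
⊕-preservesˡ-≢ k {m} {n} m≢n eq =
  ⊕-preservesʳ-≢ k m≢n (trans (⊕-comm m k) (trans eq (⊕-comm k n)))

m≢0⇒m⊕n≢n : ∀ {m} n → m ≢ 0 → m ⊕ n ≢ n
m≢0⇒m⊕n≢n n m≢0 eq = ⊕-preservesʳ-≢ n m≢0 (trans eq (sym (⊕-identityˡ n)))

m≢0⇒n⊕m≢n : ∀ {m} n → m ≢ 0 → n ⊕ m ≢ n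
m≢0⇒n⊕m≢n {m} n m≢0 eq = m≢0⇒m⊕n≢n n m≢0 (trans (⊕-comm m n) eq)

bits-<-mono : ∀ a x b y → x < y → bit a + x * 2 < bit b + y * 2
bits-<-mono a x b y x<y = begin-strict
  bit a + x * 2 ≤⟨ +-monoˡ-≤ (x * 2) (bit≤1 a) ⟩
  1 + x * 2     <⟨ *-monoˡ-≤ 2 x<y ⟩
  y * 2         ≤⟨ m≤n+m (y * 2) (bit b) ⟩
  bit b + y * 2 ∎
  where
  open ≤-Reasoning
  bit≤1 : ∀ a → bit a ≤ 1
  bit≤1 false = z≤n
  bit≤1 true  = s≤s z≤n

bits-<-inv : ∀ a x b y → bit a + x * 2 < bit b + y * 2 →
  x < y ⊎ (x ≡ y × a ≡ false × b ≡ true)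
bits-<-inv a x b y lt with <-cmp x y
... | tri< x<y _ _ = inj₁ x<y
... | tri> _ _ y<x = contradiction lt (<⇒≯ (bits-<-mono b y a x y<x))
bits-<-inv false x false .x lt | tri≈ _ refl _ = contradiction lt (<-irrefl refl)
bits-<-inv false x true  .x lt | tri≈ _ refl _ = inj₂ (refl , refl , refl)
bits-<-inv true  x false .x lt | tri≈ _ refl _ = contradiction lt (<⇒≯ (n<1+n (x * 2)))
bits-<-inv true  x true  .x lt | tri≈ _ refl _ = contradiction lt (<-irrefl refl)

⊕-mex : ∀ u v w → u < v ⊕ w → u ⊕ w < v ⊎ u ⊕ v < w
⊕-mex = binary-ind₃ (λ u v w → u < v ⊕ w → u ⊕ w < v ⊎ u ⊕ v < w) (λ ())
  λ a u b v c w ih u<v⊕w → step a u b v c w ih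
    (bits-<-inv a u (b xor c) (v ⊕ w) (subst (bit a + u * 2 <_) (⊕-bits b v c w) u<v⊕w))
  where
  step : ∀ a u b v c w → (u < v ⊕ w → u ⊕ w < v ⊎ u ⊕ v < w) →
    u < v ⊕ w ⊎ (u ≡ v ⊕ w × a ≡ false × b xor c ≡ true) →
    (bit a + u * 2) ⊕ (bit c + w * 2) < bit b + v * 2 ⊎
    (bit a + u * 2) ⊕ (bit b + v * 2) < bit c + w * 2
  step a u b v c w ih (inj₁ u<v⊕w) with ih u<v⊕w
  ... | inj₁ u⊕w<v =
    inj₁ (subst (_< bit b + v * 2) (sym (⊕-bits a u c w)) (bits-<-mono (a xor c) _ b v u⊕w<v))
  ... | inj₂ u⊕v<w =
    inj₂ (subst (_< bit c + w * 2) (sym (⊕-bits a u b v)) (bits-<-mono (a xor b) _ c w u⊕v<w))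
  step .false .(v ⊕ w) true v false w _ (inj₂ (refl , refl , refl)) =
    inj₁ (subst (_< 1 + v * 2)
                (sym (trans (⊕-bits false (v ⊕ w) false w) (cong (_* 2) (m⊕n⊕n≡m v w))))
                (n<1+n (v * 2)))
  step .false .(v ⊕ w) false v true w _ (inj₂ (refl , refl , refl)) =
    inj₂ (subst (_< 1 + w * 2)
                (sym (trans (⊕-bits false (v ⊕ w) false v) (cong (_* 2) v⊕w⊕v≡w)))
                (n<1+n (w * 2)))
    where
    v⊕w⊕v≡w : (v ⊕ w) ⊕ v ≡ w
    v⊕w⊕v≡w = trans (cong (_⊕ v) (⊕-comm v w)) (m⊕n⊕n≡m w v)

-- Nim-values of positions

data IsTerminal : Pos → Set where
  terminalL : IsTerminal *L
  terminalR : IsTerminal *R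

data NimValue : Pos → ℕ → Set

LegalOption : ℕ → Pos → Set
TerminalOrZero : Pos → Pos → Set

data NimValue where
  mk : ∀ {k g v} →
    (∀ i → LegalOption v (g i)) →
    (∀ u → 0 < u → u < v → ∃[ i ] NimValue (g i) u) →
    (v ≢ 0 → ∀ {t} → IsTerminal t → ∃[ i ] TerminalOrZero t (g i)) →
    NimValue (node k g) v

LegalOption v p = (IsTerminal p × v ≢ 0) ⊎ ∃[ w ] (NimValue p w × w ≢ v)

TerminalOrZero t p = p ≡ t ⊎ NimValue p 0

InN : Pos → Set
InN G = LeftWinsL G × RightWinsR G

mutual
  value0⇒P : ∀ {G} → NimValue G 0 → InP G
  value0⇒P (mk legal _ _) =
    (λ i → proj₂ (legal-option-of-0 (legal i))) , (λ i → proj₁ (legal-option-of-0 (legal i)))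

  legal-option-of-0 : ∀ {p} → LegalOption 0 p → InN p
  legal-option-of-0 (inj₁ (_ , 0≢0))    = ⊥-elim (0≢0 refl)
  legal-option-of-0 (inj₂ (w , n , w≢0)) = value≢0⇒N n w≢0

  value≢0⇒N : ∀ {G v} → NimValue G v → v ≢ 0 → InN G
  value≢0⇒N (mk _ _ ends) v≢0 =
    map id terminalOrZeroL⇒LeftWinsR (ends v≢0 terminalL) ,
    map id terminalOrZeroR⇒RightWinsL (ends v≢0 terminalR)

  terminalOrZeroL⇒LeftWinsR : ∀ {p} → TerminalOrZero *L p → LeftWinsR p
  terminalOrZeroL⇒LeftWinsR (inj₁ refl) = tt
  terminalOrZeroL⇒LeftWinsR (inj₂ n) = proj₂ (value0⇒P n)

  terminalOrZeroR⇒RightWinsL : ∀ {p} → TerminalOrZero *R p → RightWinsL p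
  terminalOrZeroR⇒RightWinsL (inj₁ refl) = tt
  terminalOrZeroR⇒RightWinsL (inj₂ n) = proj₁ (value0⇒P n)

mutual
  LeftWinsL⇒¬RightWinsL : ∀ G → LeftWinsL G → RightWinsL G → ⊥
  LeftWinsL⇒¬RightWinsL *L _ ()
  LeftWinsL⇒¬RightWinsL (node k g) (i , l) r = LeftWinsR⇒¬RightWinsR (g i) l (r i)

  LeftWinsR⇒¬RightWinsR : ∀ G → LeftWinsR G → RightWinsR G → ⊥
  LeftWinsR⇒¬RightWinsR *R () _
  LeftWinsR⇒¬RightWinsR (node k g) l (i , r) = LeftWinsL⇒¬RightWinsL (g i) (l i) r

P⇒value≡0 : ∀ {G v} → NimValue G v → InP G → v ≡ 0
P⇒value≡0 {v = zero}  _ _ = refl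
P⇒value≡0 {G} {suc v} val (rightWins , _) =
  ⊥-elim (LeftWinsL⇒¬RightWinsL G (proj₁ (value≢0⇒N val λ ())) rightWins)

starOpts-terminal : ∀ m {t} → IsTerminal t → ∃[ i ] starOpts m i ≡ t
starOpts-terminal zero    terminalL = zero , refl
starOpts-terminal zero    terminalR = suc zero , refl
starOpts-terminal (suc m) τ         = map suc id (starOpts-terminal m τ)

mutual
  ★-value : ∀ m → NimValue ★[1+ m ] (suc m)
  ★-value m =
    mk (λ i → legal (starOpts-value m i))
       (λ u 0<u u<1+m → starOpts-of-value m 0<u (≤-pred u<1+m))
       (λ _ τ → map id inj₁ (starOpts-terminal m τ))
    where
    legal : ∀ {p} → IsTerminal p ⊎ ∃[ w ] (NimValue p w × w ≤ m) → LegalOption (suc m) p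
    legal (inj₁ τ)             = inj₁ (τ , λ ())
    legal (inj₂ (w , n , w≤m)) = inj₂ (w , n , λ { refl → 1+n≰n w≤m })

  starOpts-value : ∀ m i →
    IsTerminal (starOpts m i) ⊎ ∃[ w ] (NimValue (starOpts m i) w × w ≤ m)
  starOpts-value zero    zero       = inj₁ terminalL
  starOpts-value zero    (suc zero) = inj₁ terminalR
  starOpts-value (suc m) zero       = inj₂ (suc m , ★-value m , ≤-refl)
  starOpts-value (suc m) (suc i) with starOpts-value m i
  ... | inj₁ τ             = inj₁ τ
  ... | inj₂ (w , n , w≤m) = inj₂ (w , n , m≤n⇒m≤1+n w≤m)

  starOpts-of-value : ∀ m {u} → 0 < u → u ≤ m → ∃[ i ] NimValue (starOpts m i) u
  starOpts-of-value zero    (s≤s _) ()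
  starOpts-of-value (suc m) 0<u u≤1+m with m≤n⇒m<n∨m≡n u≤1+m
  ... | inj₂ refl  = zero , ★-value m
  ... | inj₁ u<1+m = map suc id (starOpts-of-value m 0<u (≤-pred u<1+m))

★-value′ : ∀ m .{{_ : NonZero m}} → NimValue (★ m) m
★-value′ (suc m) = ★-value m

module _ (φ : Pos → Pos)
         (φ-node : ∀ k g → φ (node k g) ≡ node k (φ ∘ g))
         (φ-terminal : ∀ {t} → IsTerminal t → IsTerminal (φ t))
         (φ-involutive : ∀ {t} → IsTerminal t → φ (φ t) ≡ t) where

  mutual
    relabel-value : ∀ {G v} → NimValue G v → NimValue (φ G) v
    relabel-value {node k g} {v} (mk legal mex ends) =
      subst (λ H → NimValue H v) (sym (φ-node k g)) (mk (λ i → relabel-legal (legal i))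
          (λ u 0<u u<v → relabel-option (mex u 0<u u<v))
          (λ v≢0 τ → relabel-end τ (ends v≢0 (φ-terminal τ))))

    relabel-legal : ∀ {p v} → LegalOption v p → LegalOption v (φ p)
    relabel-legal (inj₁ (τ , v≢0))     = inj₁ (φ-terminal τ , v≢0)
    relabel-legal (inj₂ (w , n , w≢v)) = inj₂ (w , relabel-value n , w≢v)

    relabel-option : ∀ {k} {g : Fin (suc k) → Pos} {u} →
      ∃[ i ] NimValue (g i) u → ∃[ i ] NimValue (φ (g i)) u
    relabel-option (i , n) = i , relabel-value n

    relabel-end : ∀ {k} {g : Fin (suc k) → Pos} {t} → IsTerminal t →
      ∃[ i ] TerminalOrZero (φ t) (g i) → ∃[ i ] TerminalOrZero t (φ (g i))
    relabel-end τ (i , inj₁ gᵢ≡φt) = i , inj₁ (trans (cong φ gᵢ≡φt) (φ-involutive τ))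
    relabel-end τ (i , inj₂ n)     = i , inj₂ (relabel-value n)

⊞-terminal : ∀ {s t} → IsTerminal s → IsTerminal t → IsTerminal (s ⊞ t)
⊞-terminal terminalL terminalL = terminalL
⊞-terminal terminalL terminalR = terminalR
⊞-terminal terminalR terminalL = terminalR
⊞-terminal terminalR terminalR = terminalL

⊞-terminal-involutiveʳ : ∀ {s t} → IsTerminal s → IsTerminal t → (t ⊞ s) ⊞ s ≡ t
⊞-terminal-involutiveʳ terminalL terminalL = refl
⊞-terminal-involutiveʳ terminalL terminalR = refl
⊞-terminal-involutiveʳ terminalR terminalL = refl
⊞-terminal-involutiveʳ terminalR terminalR = refl

⊞-terminal-involutiveˡ : ∀ {s t} → IsTerminal s → IsTerminal t → s ⊞ (s ⊞ t) ≡ t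
⊞-terminal-involutiveˡ terminalL terminalL = refl
⊞-terminal-involutiveˡ terminalL terminalR = refl
⊞-terminal-involutiveˡ terminalR terminalL = refl
⊞-terminal-involutiveˡ terminalR terminalR = refl

node-⊞-terminal : ∀ {s} k g → IsTerminal s → node k g ⊞ s ≡ node k (λ i → g i ⊞ s)
node-⊞-terminal k g terminalL = refl
node-⊞-terminal k g terminalR = refl

terminal-⊞-node : ∀ {s} k g → IsTerminal s → s ⊞ node k g ≡ node k (λ i → s ⊞ g i)
terminal-⊞-node k g terminalL = refl
terminal-⊞-node k g terminalR = refl

⊞-terminal-valueʳ : ∀ {G s v} → IsTerminal s → NimValue G v → NimValue (G ⊞ s) v
⊞-terminal-valueʳ {s = s} σ = relabel-value (_⊞ s) (λ k g → node-⊞-terminal k g σ)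
  (λ τ → ⊞-terminal τ σ) (⊞-terminal-involutiveʳ σ)

⊞-terminal-valueˡ : ∀ {G s v} → IsTerminal s → NimValue G v → NimValue (s ⊞ G) v
⊞-terminal-valueˡ {s = s} σ = relabel-value (s ⊞_) (λ k g → terminal-⊞-node k g σ)
  (⊞-terminal σ) (⊞-terminal-involutiveˡ σ)

module _ {k m} {g : Fin (suc k) → Pos} {h : Fin (suc m) → Pos} where

  ⊞-move : Fin (suc k) ⊎ Fin (suc m) → Pos
  ⊞-move = [ (λ i → g i ⊞ node m h) , (λ j → node k g ⊞ h j) ]′

  ⊞-option : Fin (suc (k + suc m)) → Pos
  ⊞-option x = ⊞-move (splitAt (suc k) x)

  all-⊞-options : (P : Pos → Set) →
    (∀ i → P (g i ⊞ node m h)) → (∀ j → P (node k g ⊞ h j)) → ∀ x → P (⊞-option x)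
  all-⊞-options P onLeft onRight x with splitAt (suc k) x
  ... | inj₁ i = onLeft i
  ... | inj₂ j = onRight j

  any-⊞-optionˡ : (P : Pos → Set) → ∃[ i ] P (g i ⊞ node m h) → ∃[ x ] P (⊞-option x)
  any-⊞-optionˡ P (i , p) =
    i ↑ˡ suc m , subst (P ∘ ⊞-move) (sym (splitAt-↑ˡ (suc k) i (suc m))) p

  any-⊞-optionʳ : (P : Pos → Set) → ∃[ j ] P (node k g ⊞ h j) → ∃[ x ] P (⊞-option x)
  any-⊞-optionʳ P (j , p) =
    suc k ↑ʳ j , subst (P ∘ ⊞-move) (sym (splitAt-↑ʳ (suc k) (suc m) j)) p

mutual
  ⊞-value : ∀ {G H v w} → NimValue G v → NimValue H w → NimValue (G ⊞ H) (v ⊕ w)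
  ⊞-value {v = v} {w} valG@(mk legalG _ _) valH@(mk legalH _ _) =
    mk (all-⊞-options (LegalOption (v ⊕ w)) (λ i → legal-⊞ˡ (legalG i) valH)
                                             (λ j → legal-⊞ʳ valG (legalH j)))
       (λ u _ u<v⊕w → ⊞-option-of-value valG valH u<v⊕w)
       (λ v⊕w≢0 _ → map id inj₂ (⊞-option-of-value valG valH (n≢0⇒n>0 v⊕w≢0)))

  legal-⊞ˡ : ∀ {p H v w} → LegalOption v p → NimValue H w → LegalOption (v ⊕ w) (p ⊞ H)
  legal-⊞ˡ {w = w} (inj₁ (τ , v≢0)) valH =
    inj₂ (w , ⊞-terminal-valueˡ τ valH , m≢0⇒m⊕n≢n w v≢0 ∘ sym)
  legal-⊞ˡ {w = w} (inj₂ (v′ , val , v′≢v)) valH =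
    inj₂ (v′ ⊕ w , ⊞-value val valH , ⊕-preservesʳ-≢ w v′≢v)

  legal-⊞ʳ : ∀ {G q v w} → NimValue G v → LegalOption w q → LegalOption (v ⊕ w) (G ⊞ q)
  legal-⊞ʳ {v = v} valG (inj₁ (τ , w≢0)) =
    inj₂ (v , ⊞-terminal-valueʳ τ valG , m≢0⇒n⊕m≢n v w≢0 ∘ sym)
  legal-⊞ʳ {v = v} valG (inj₂ (w′ , val , w′≢w)) =
    inj₂ (v ⊕ w′ , ⊞-value valG val , ⊕-preservesˡ-≢ v w′≢w)

  ⊞-option-of-value : ∀ {k m} {g : Fin (suc k) → Pos} {h : Fin (suc m) → Pos} {u v w} →
    NimValue (node k g) v → NimValue (node m h) w → u < v ⊕ w →
    ∃[ x ] NimValue (⊞-option {g = g} {h} x) u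
  ⊞-option-of-value {u = u} {v} {w} valG valH u<v⊕w with ⊕-mex u v w u<v⊕w
  ... | inj₁ u⊕w<v = any-⊞-optionˡ (λ p → NimValue p u) (left-option-of-value valG valH u⊕w<v)
  ... | inj₂ u⊕v<w = any-⊞-optionʳ (λ p → NimValue p u) (right-option-of-value valG valH u⊕v<w)

  left-option-of-value : ∀ {k} {g : Fin (suc k) → Pos} {H u v w} →
    NimValue (node k g) v → NimValue H w → u ⊕ w < v → ∃[ i ] NimValue (g i ⊞ H) u
  left-option-of-value {u = u} {v} {w} (mk _ mex ends) valH u⊕w<v with u ⊕ w ≟ 0
  ... | yes u⊕w≡0 = map id (subst (NimValue _) (sym (m⊕n≡0⇒m≡n u⊕w≡0)))
                           (terminalOrZero-⊞ˡ-option (ends (m<n⇒n≢0 u⊕w<v) terminalL) valH)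
  ... | no u⊕w≢0  = map id (subst (NimValue _) (m⊕n⊕n≡m u w))
                           (⊞-valueˡ-option (mex (u ⊕ w) (n≢0⇒n>0 u⊕w≢0) u⊕w<v) valH)

  right-option-of-value : ∀ {m} {h : Fin (suc m) → Pos} {G u v w} →
    NimValue G v → NimValue (node m h) w → u ⊕ v < w → ∃[ j ] NimValue (G ⊞ h j) u
  right-option-of-value {u = u} {v} {w} valG (mk _ mex ends) u⊕v<w with u ⊕ v ≟ 0
  ... | yes u⊕v≡0 = map id (subst (NimValue _) (sym (m⊕n≡0⇒m≡n u⊕v≡0)))
                           (terminalOrZero-⊞ʳ-option valG (ends (m<n⇒n≢0 u⊕v<w) terminalL))
  ... | no u⊕v≢0  = map id (subst (NimValue _) (trans (⊕-comm v (u ⊕ v)) (m⊕n⊕n≡m u v)))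
                           (⊞-valueʳ-option valG (mex (u ⊕ v) (n≢0⇒n>0 u⊕v≢0) u⊕v<w))

  ⊞-valueˡ-option : ∀ {k} {g : Fin (suc k) → Pos} {H v w} →
    ∃[ i ] NimValue (g i) v → NimValue H w → ∃[ i ] NimValue (g i ⊞ H) (v ⊕ w)
  ⊞-valueˡ-option (i , val) valH = i , ⊞-value val valH

  ⊞-valueʳ-option : ∀ {m} {h : Fin (suc m) → Pos} {G v w} →
    NimValue G v → ∃[ j ] NimValue (h j) w → ∃[ j ] NimValue (G ⊞ h j) (v ⊕ w)
  ⊞-valueʳ-option valG (j , val) = j , ⊞-value valG val

  terminalOrZero-⊞ˡ-option : ∀ {k} {g : Fin (suc k) → Pos} {H w} →
    ∃[ i ] TerminalOrZero *L (g i) → NimValue H w → ∃[ i ] NimValue (g i ⊞ H) w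
  terminalOrZero-⊞ˡ-option {H = H} {w} (i , inj₁ gᵢ≡*L) valH =
    i , subst (λ p → NimValue (p ⊞ H) w) (sym gᵢ≡*L) (⊞-terminal-valueˡ terminalL valH)
  terminalOrZero-⊞ˡ-option {w = w} (i , inj₂ val) valH =
    i , subst (NimValue _) (⊕-identityˡ w) (⊞-value val valH)

  terminalOrZero-⊞ʳ-option : ∀ {m} {h : Fin (suc m) → Pos} {G v} →
    NimValue G v → ∃[ j ] TerminalOrZero *L (h j) → ∃[ j ] NimValue (G ⊞ h j) v
  terminalOrZero-⊞ʳ-option {G = G} {v} valG (j , inj₁ hⱼ≡*L) =
    j , subst (λ q → NimValue (G ⊞ q) v) (sym hⱼ≡*L) (⊞-terminal-valueʳ terminalL valG)
  terminalOrZero-⊞ʳ-option {v = v} valG (j , inj₂ val) =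
    j , subst (NimValue _) (⊕-identityʳ v) (⊞-value valG val)

sumPos-value : ∀ n {G : Fin (suc n) → Pos} {a : Fin (suc n) → ℕ} →
  (∀ i → NimValue (G i) (a i)) → NimValue (sumPos n G) (xorAll n a)
sumPos-value zero    val = val zero
sumPos-value (suc n) val = ⊞-value (sumPos-value n (val ∘ inject₁)) (val (fromℕ (suc n)))

theorem3p8 : (n : ℕ) (a : Fin (suc n) → ℕ) (pos : (i : Fin (suc n)) → NonZero (a i)) →
    InP (sumPos n (λ i → ★ (a i) {{pos i}})) ⇔ (xorAll n a ≡ 0)
theorem3p8 n a pos =
  mk⇔ (P⇒value≡0 value) (λ xor≡0 → value0⇒P (subst (NimValue _) xor≡0 value))
  where
  value : NimValue (sumPos n (λ i → ★ (a i) {{pos i}})) (xorAll n a)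
  value = sumPos-value n (λ i → ★-value′ (a i) {{pos i}})
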